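{- Let $q=2^n$, $r=2$, $k=q+1$, $0\le a,b\le q-2$, and $c:=1+\omega^{ak}+\omega^{bk}\in\mathbb{F}_q$. Then $(a,b)_{q-1}=1$ if $c=0$; $(a,b)_{q-1}=0$ if $c\ne0$ and $\mathrm{Tr}_{\mathbb{F}_q/\mathbb{F}_2}(\omega^{ak}/c^2)=0$; and $(a,b)_{q-1}=2$ if $c\neq0$ and $\mathrm{Tr}_{\mathbb{F}_q/\mathbb{F}_2}(\omega^{ak}/c^2)=1$.
   Context: Fix a generator $\omega$ of $\mathbb{F}_{q^2}^\times$; let $e=q-1$, $C_a:=\omega^a\langle\omega^e\rangle$ and $(a,b)_e:=\#\{x\in C_a\mid x+1\in C_b\}$. $\mathrm{Tr}_{\mathbb{F}_q/\mathbb{F}_2}$ is the absolute trace. -}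

module Defs where

open import Data.Nat as ℕ using (ℕ; zero; suc; _∸_)
open import Data.Bool using (Bool; true; false; _∧_)
open import Data.List using (List; []; _∷_; length; filterᵇ; upTo)
open import Data.Bool.ListAction using (any)
open import Data.List.Membership.Propositional using (_∈_)
open import Data.List.Relation.Unary.Unique.Propositional using (Unique)
open import Relation.Nullary using (¬_; Dec; does)
open import Relation.Binary.PropositionalEquality using (_≡_)
import Algebra.Structures as AS

record FiniteField (m : ℕ) : Set₁ where
  infixl 6 _+_
  infixl 7 _*_
  infix 4 _≟_
  field
    Carrier    : Set
    _+_ _*_    : Carrier → Carrier → Carrier
    -_         : Carrier → Carrier
    0# 1#      : Carrier
    _⁻¹        : Carrier → Carrier
    isCommutativeRing : AS.IsCommutativeRing _≡_ _+_ _*_ -_ 0# 1#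
    0≢1        : ¬ (0# ≡ 1#)
    ⁻¹-inverse : ∀ x → ¬ (x ≡ 0#) → x * (x ⁻¹) ≡ 1#
    _≟_        : (x y : Carrier) → Dec (x ≡ y)
    elements   : List Carrier
    complete   : ∀ x → x ∈ elements
    unique     : Unique elements
    card       : length elements ≡ m

  infixr 8 _^_
  _^_ : Carrier → ℕ → Carrier
  x ^ zero  = 1#
  x ^ suc i = x * (x ^ i)

  _/_ : Carrier → Carrier → Carrier
  x / y = x * (y ⁻¹)

  IsPrimitive : Carrier → Set
  IsPrimitive ω = ∀ x → ¬ (x ≡ 0#) → Σ' x
    where
    Σ' : Carrier → Set
    Σ' x = Data.Product.∃ λ i → ω ^ i ≡ x
      where import Data.Product

  -- membership in the cyclotomic class C_a = ω^a ⟨ω^e⟩ of order e.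
  -- ⟨ω^e⟩ = { (ω^e)^j | j < m - 1 }  (all powers, since |F^×| = m - 1).
  inClass : (ω : Carrier) (e a : ℕ) → Carrier → Bool
  inClass ω e a x = any (λ j → does ((ω ^ a) * ((ω ^ e) ^ j) ≟ x)) (upTo (m ∸ 1))

  cyclotomicNumber : (ω : Carrier) (e a b : ℕ) → ℕ
  cyclotomicNumber ω e a b =
    length (filterᵇ (λ x → inClass ω e a x ∧ inClass ω e b (x + 1#)) elements)

  -- Tr(y) = y + y^2 + y^4 + ... + y^(2^(n-1))  (absolute trace F_{2^n} → F_2,
  -- applied to y in the subfield of order 2^n)
  trace : (n : ℕ) → Carrier → Carrier
  trace zero    y = 0#
  trace (suc i) y = trace i y + y ^ (2 ℕ.^ i)

module _ {m : ℕ} (K : FiniteField m) where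
  open FiniteField K

  cValue : (ω : Carrier) (n a b : ℕ) → Carrier
  cValue ω n a b = (1# + (ω ^ (a ℕ.* ((2 ℕ.^ n) ℕ.+ 1)))) + (ω ^ (b ℕ.* ((2 ℕ.^ n) ℕ.+ 1)))

  traceValue : (ω : Carrier) (n a b : ℕ) → Carrier
  traceValue ω n a b =
    trace n ((ω ^ (a ℕ.* ((2 ℕ.^ n) ℕ.+ 1))) / ((cValue ω n a b) ^ 2))

-- Let q = 2ⁿ, k = q + 1, and let N x = x^q x and T x = x^q + x be the norm and trace of
-- F_{q²}/F_q. The subgroup ⟨ω^(q-1)⟩ is the kernel of N, so x ∈ C_a iff N x = ω^(ak); since
-- N (x + 1) = N x + T x + 1, (a,b)_{q-1} counts the x with N x = A := ω^(ak) and T x = c.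
-- If c = 0 then x ∈ F_q and x² = A, which has exactly one solution because squaring is
-- injective in characteristic 2. If c ≠ 0, put x = c y: the conditions become y² + y = γ with
-- γ = A/c² (and T y = 1, which then follows). As Tr(y² + y) = y^q + y = T y, there is no
-- solution when Tr γ = 0; when Tr γ = 1 an explicit Artin–Schreier root y₀ exists in F_{q²},
-- and the solutions are exactly c y₀ and c (y₀ + 1).
module Submission where

open import Defs

open import Algebra.Bundles using (CommutativeRing)
import Algebra.Properties.CommutativeSemiring.Exp
import Algebra.Properties.Ring as RingProperties
open import Data.Bool using (Bool; T; _∧_)
open import Data.Bool.Properties using (T-∧)
open import Data.Empty using (⊥-elim)
open import Data.Fin using (Fin; toℕ; zero; suc)
open import Data.Fin.Properties using (pigeonhole; toℕ<n)
open import Data.List using (List; []; _∷_; length; lookup; filter; filterᵇ; deduplicate; applyUpTo; upTo)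
open import Data.List.Properties using (length-filter; length-deduplicate; length-applyUpTo)
import Data.List.Membership.DecPropositional as DecMembership
open import Data.List.Membership.Propositional using (_∈_; lose)
open import Data.List.Membership.Propositional.Properties
  using (∈-filter⁺; ∈-filter⁻; ∈-deduplicate⁺; ∈-applyUpTo⁺; ∈-upTo⁺)
open import Data.List.Membership.Propositional.Properties.WithK using (unique∧set⇒bag)
open import Data.List.Relation.Binary.BagAndSetEquality using (_∼[_]_; set; ∼bag⇒↭)
open import Data.List.Relation.Binary.Permutation.Propositional.Properties using (↭-length)
open import Data.List.Relation.Unary.All using ([]; _∷_)
open import Data.List.Relation.Unary.AllPairs using ([]; _∷_)
open import Data.List.Relation.Unary.Any using (here; there; index; satisfied)
open import Data.List.Relation.Unary.Any.Properties using (lookup-index; any⁻; any⁺)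
open import Data.List.Relation.Unary.Unique.Propositional using (Unique)
import Data.List.Relation.Unary.Unique.Propositional.Properties as Unique
open import Data.List.Relation.Unary.Unique.DecPropositional.Properties using (deduplicate-!)
open import Data.Nat as ℕ using (ℕ; zero; suc; pred; _≤_; _<_; _∸_; z≤n; s≤s)
import Data.Nat.Properties as ℕ
open import Data.Nat.DivMod using (_%_; m≡m%n+[m/n]*n; m%n<n)
open import Data.Nat.Divisibility
  using (_∣_; ∣⇒≤; m%n≡0⇒n∣m; *-cancelʳ-∣; quotient; m∣n⇒n≡m*quotient)
open import Data.Nat.Tactic.RingSolver using (solve-∀)
open import Data.Product using (∃; _×_; _,_; proj₁; proj₂)
open import Data.Sum as Sum using (_⊎_; inj₁; inj₂; [_,_])
open import Data.Unit using (tt)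
open import Function using (_⇔_; mk⇔; _∘_; id; Equivalence)
import Function.Properties.Equivalence as ⇔
open import Level using (0ℓ)
open import Relation.Binary.Definitions using (DecidableEquality)
open import Relation.Binary.PropositionalEquality
  using (_≡_; _≢_; refl; sym; trans; cong; cong₂; subst; module ≡-Reasoning)
open import Relation.Nullary using (Dec; yes; no; does)
open import Relation.Nullary.Decidable using (T?)

module _ {A : Set} where

  unique∧set⇒length≡ : {xs ys : List A} → Unique xs → Unique ys → xs ∼[ set ] ys →
                       length xs ≡ length ys
  unique∧set⇒length≡ u v xs∼ys = ↭-length (∼bag⇒↭ (unique∧set⇒bag u v xs∼ys))

  unique∧⊆⇒length≤ : DecidableEquality A → {xs ys : List A} → Unique xs →
                     (∀ {x} → x ∈ xs → x ∈ ys) → length xs ≤ length ys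
  unique∧⊆⇒length≤ _≟_ {xs} {ys} xs-unique xs⊆ys = begin
    length xs                     ≡⟨ unique∧set⇒length≡ xs-unique zs-unique xs∼zs ⟩
    length (filter (_∈? xs) ys′)  ≤⟨ length-filter (_∈? xs) ys′ ⟩
    length ys′                    ≤⟨ length-deduplicate _≟_ ys ⟩
    length ys                     ∎
    where
    open ℕ.≤-Reasoning
    open DecMembership _≟_ using (_∈?_)
    ys′ = deduplicate _≟_ ys
    zs-unique : Unique (filter (_∈? xs) ys′)
    zs-unique = Unique.filter⁺ (_∈? xs) (deduplicate-! _≟_ ys)
    xs∼zs : xs ∼[ set ] filter (_∈? xs) ys′
    xs∼zs = mk⇔ (λ x∈xs → ∈-filter⁺ (_∈? xs) (∈-deduplicate⁺ _≟_ (xs⊆ys x∈xs)) x∈xs)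
                (proj₂ ∘ ∈-filter⁻ (_∈? xs) {xs = ys′})

[q∸1]*[q+1]≡q*q∸1 : ∀ q → (q ∸ 1) ℕ.* (q ℕ.+ 1) ≡ q ℕ.* q ∸ 1
[q∸1]*[q+1]≡q*q∸1 zero    = refl
[q∸1]*[q+1]≡q*q∸1 (suc k) = lemma k
  where
  lemma : ∀ k → k ℕ.* (suc k ℕ.+ 1) ≡ k ℕ.+ k ℕ.* suc k
  lemma = solve-∀

module FieldProperties {m : ℕ} (K : FiniteField m) where
  open FiniteField K
  open ≡-Reasoning

  commutativeRing : CommutativeRing 0ℓ 0ℓ
  commutativeRing = record { isCommutativeRing = isCommutativeRing }

  open CommutativeRing commutativeRing public
    using ( +-comm; +-assoc; +-identityˡ; +-identityʳ; -‿inverseʳ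
          ; *-comm; *-assoc; *-identityˡ; *-identityʳ; zeroˡ; zeroʳ; distribˡ
          ; commutativeSemiring; ring )
  open import Algebra.Solver.Ring.NaturalCoefficients.Default commutativeSemiring public
    using (solve; _:+_; _:*_; _:=_; con)
  private module Exp = Algebra.Properties.CommutativeSemiring.Exp commutativeSemiring

  ^≡Exp^ : ∀ x i → x ^ i ≡ x Exp.^ i
  ^≡Exp^ x zero    = refl
  ^≡Exp^ x (suc i) = cong (x *_) (^≡Exp^ x i)

  ^-homo-* : ∀ x i j → x ^ (i ℕ.+ j) ≡ x ^ i * x ^ j
  ^-homo-* x i j rewrite ^≡Exp^ x (i ℕ.+ j) | ^≡Exp^ x i | ^≡Exp^ x j = Exp.^-homo-* x i j

  ^-assocʳ : ∀ x i j → (x ^ i) ^ j ≡ x ^ (i ℕ.* j)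
  ^-assocʳ x i j rewrite ^≡Exp^ (x ^ i) j | ^≡Exp^ x i | ^≡Exp^ x (i ℕ.* j) = Exp.^-assocʳ x i j

  ^-distrib-* : ∀ x y i → (x * y) ^ i ≡ x ^ i * y ^ i
  ^-distrib-* x y i rewrite ^≡Exp^ (x * y) i | ^≡Exp^ x i | ^≡Exp^ y i = Exp.^-distrib-* x y i

  ^-comm : ∀ x i j → (x ^ i) ^ j ≡ (x ^ j) ^ i
  ^-comm x i j = trans (^-assocʳ x i j) (trans (cong (x ^_) (ℕ.*-comm i j)) (sym (^-assocʳ x j i)))

  ^-suc : ∀ x i → x ^ (i ℕ.+ 1) ≡ x ^ i * x
  ^-suc x i = trans (^-homo-* x i 1) (cong (x ^ i *_) (*-identityʳ x))

  1^ : ∀ i → 1# ^ i ≡ 1#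
  1^ zero    = refl
  1^ (suc i) = trans (*-identityˡ _) (1^ i)

  0^ : ∀ i .{{_ : ℕ.NonZero i}} → 0# ^ i ≡ 0#
  0^ (suc i) = zeroˡ _

  ^-*-≡1 : ∀ {x d} → x ^ d ≡ 1# → ∀ k → x ^ (k ℕ.* d) ≡ 1#
  ^-*-≡1 {x} {d} xᵈ≡1 k = begin
    x ^ (k ℕ.* d) ≡⟨ cong (x ^_) (ℕ.*-comm k d) ⟩
    x ^ (d ℕ.* k) ≡⟨ sym (^-assocʳ x d k) ⟩
    (x ^ d) ^ k   ≡⟨ cong (_^ k) xᵈ≡1 ⟩
    1# ^ k        ≡⟨ 1^ k ⟩
    1#            ∎

  ^-% : ∀ {x d} .{{_ : ℕ.NonZero d}} → x ^ d ≡ 1# → ∀ i → x ^ i ≡ x ^ (i % d)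
  ^-% {x} {d} xᵈ≡1 i = begin
    x ^ i                               ≡⟨ cong (x ^_) (m≡m%n+[m/n]*n i d) ⟩
    x ^ (i % d ℕ.+ i ℕ./ d ℕ.* d)       ≡⟨ ^-homo-* x (i % d) (i ℕ./ d ℕ.* d) ⟩
    x ^ (i % d) * x ^ (i ℕ./ d ℕ.* d)   ≡⟨ cong (x ^ (i % d) *_) (^-*-≡1 xᵈ≡1 (i ℕ./ d)) ⟩
    x ^ (i % d) * 1#                    ≡⟨ *-identityʳ _ ⟩
    x ^ (i % d)                         ∎

  ⁻¹-inverseˡ : ∀ {x} → x ≢ 0# → x ⁻¹ * x ≡ 1#
  ⁻¹-inverseˡ {x} x≢0 = trans (*-comm (x ⁻¹) x) (⁻¹-inverse x x≢0)

  ⁻¹-cancelˡ : ∀ {x} y → x ≢ 0# → x ⁻¹ * (x * y) ≡ y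
  ⁻¹-cancelˡ {x} y x≢0 = begin
    x ⁻¹ * (x * y) ≡⟨ sym (*-assoc (x ⁻¹) x y) ⟩
    x ⁻¹ * x * y   ≡⟨ cong (_* y) (⁻¹-inverseˡ x≢0) ⟩
    1# * y         ≡⟨ *-identityˡ y ⟩
    y              ∎

  *-/-cancelˡ : ∀ {x} y → x ≢ 0# → x * (y * x ⁻¹) ≡ y
  *-/-cancelˡ {x} y x≢0 = begin
    x * (y * x ⁻¹) ≡⟨ solve 3 (λ x y i → x :* (y :* i) := y :* (x :* i)) refl x y (x ⁻¹) ⟩
    y * (x * x ⁻¹) ≡⟨ cong (y *_) (⁻¹-inverse x x≢0) ⟩
    y * 1#         ≡⟨ *-identityʳ y ⟩
    y              ∎

  *-cancelˡ : ∀ {x y z} → x ≢ 0# → x * y ≡ x * z → y ≡ z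
  *-cancelˡ {x} {y} {z} x≢0 eq =
    trans (sym (⁻¹-cancelˡ y x≢0)) (trans (cong (x ⁻¹ *_) eq) (⁻¹-cancelˡ z x≢0))

  x*y≡0⇒x≡0⊎y≡0 : ∀ {x y} → x * y ≡ 0# → x ≡ 0# ⊎ y ≡ 0#
  x*y≡0⇒x≡0⊎y≡0 {x} {y} xy≡0 with x ≟ 0#
  ... | yes x≡0 = inj₁ x≡0
  ... | no x≢0  = inj₂ (*-cancelˡ x≢0 (trans xy≡0 (sym (zeroʳ x))))

  *≢0 : ∀ {x y} → x ≢ 0# → y ≢ 0# → x * y ≢ 0#
  *≢0 x≢0 y≢0 xy≡0 = [ x≢0 , y≢0 ] (x*y≡0⇒x≡0⊎y≡0 xy≡0)

  ^≢0 : ∀ {x} i → x ≢ 0# → x ^ i ≢ 0#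
  ^≢0 zero    x≢0 = 0≢1 ∘ sym
  ^≢0 (suc i) x≢0 = *≢0 x≢0 (^≢0 i x≢0)

  ⁻¹-unique : ∀ {x y} → x * y ≡ 1# → y ≡ x ⁻¹
  ⁻¹-unique {x} {y} xy≡1 = *-cancelˡ x≢0 (trans xy≡1 (sym (⁻¹-inverse x x≢0)))
    where
    x≢0 : x ≢ 0#
    x≢0 x≡0 = 0≢1 (trans (sym (zeroˡ y)) (trans (cong (_* y) (sym x≡0)) xy≡1))

  ^-⁻¹ : ∀ {x} i → x ≢ 0# → (x ⁻¹) ^ i ≡ (x ^ i) ⁻¹
  ^-⁻¹ {x} i x≢0 = ⁻¹-unique (begin
    x ^ i * (x ⁻¹) ^ i ≡⟨ sym (^-distrib-* x (x ⁻¹) i) ⟩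
    (x * x ⁻¹) ^ i     ≡⟨ cong (_^ i) (⁻¹-inverse x x≢0) ⟩
    1# ^ i             ≡⟨ 1^ i ⟩
    1#                 ∎)

  ≟-sound : ∀ {x y} → T (does (x ≟ y)) → x ≡ y
  ≟-sound {x} {y} _ with x ≟ y
  ... | yes x≡y = x≡y

  ≟-complete : ∀ {x y} → x ≡ y → T (does (x ≟ y))
  ≟-complete {x} {y} x≡y with x ≟ y
  ... | yes _  = tt
  ... | no x≢y = x≢y x≡y

  card≤length : (ys : List Carrier) → (∀ x → x ∈ ys) → m ≤ length ys
  card≤length ys ys-complete =
    subst (_≤ length ys) card (unique∧⊆⇒length≤ _≟_ unique (λ {x} _ → ys-complete x))

  length-filterᵇ≡ : (p : Carrier → Bool) (S : List Carrier) → Unique S →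
                    (∀ x → T (p x) ⇔ x ∈ S) → length (filterᵇ p elements) ≡ length S
  length-filterᵇ≡ p S S-unique p⇔∈S =
    unique∧set⇒length≡ (Unique.filter⁺ (T? ∘ p) unique) S-unique λ {x} → mk⇔
      (λ x∈ → Equivalence.to (p⇔∈S x) (proj₂ (∈-filter⁻ (T? ∘ p) {xs = elements} x∈)))
      (λ x∈S → ∈-filter⁺ (T? ∘ p) (complete x) (Equivalence.from (p⇔∈S x) x∈S))

module PrimitiveElement {m : ℕ} (K : FiniteField m) {ω : FiniteField.Carrier K}
                        (ω-primitive : FiniteField.IsPrimitive K ω) (2<m : 2 < m) where
  open FiniteField K
  open FieldProperties K

  -- 2 < m is needed: in the field with two elements, 0 satisfies IsPrimitive.
  ω≢0 : ω ≢ 0#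
  ω≢0 ω≡0 = ℕ.<⇒≱ 2<m (card≤length (0# ∷ 1# ∷ []) ⊆01)
    where
    ⊆01 : ∀ x → x ∈ 0# ∷ 1# ∷ []
    ⊆01 x with x ≟ 0#
    ... | yes x≡0 = here x≡0
    ... | no x≢0 with ω-primitive x x≢0
    ...   | zero  , 1≡x    = there (here (sym 1≡x))
    ...   | suc i , ωⁱ⁺¹≡x =
      ⊥-elim (x≢0 (trans (sym ωⁱ⁺¹≡x) (trans (cong (_* ω ^ i) ω≡0) (zeroˡ _))))

  N : ℕ
  N = m ∸ 1

  m≡1+N : m ≡ suc N
  m≡1+N = sym (ℕ.suc-pred m {{ℕ.>-nonZero (ℕ.<-trans (s≤s z≤n) 2<m)}})

  instance
    N-nonZero : ℕ.NonZero N
    N-nonZero = ℕ.>-nonZero (ℕ.<-≤-trans (s≤s z≤n) (ℕ.≤-pred (subst (2 <_) m≡1+N 2<m)))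

  N≤period : ∀ d .{{_ : ℕ.NonZero d}} → ω ^ d ≡ 1# → N ≤ d
  N≤period d ωᵈ≡1 = ℕ.≤-pred (begin
    suc N                               ≡⟨ sym m≡1+N ⟩
    m                                   ≤⟨ card≤length (0# ∷ applyUpTo (ω ^_) d) ⊆powers ⟩
    suc (length (applyUpTo (ω ^_) d))   ≡⟨ cong suc (length-applyUpTo (ω ^_) d) ⟩
    suc d                               ∎)
    where
    open ℕ.≤-Reasoning
    ⊆powers : ∀ x → x ∈ 0# ∷ applyUpTo (ω ^_) d
    ⊆powers x with x ≟ 0#
    ... | yes x≡0 = here x≡0
    ... | no x≢0 with ω-primitive x x≢0
    ...   | i , ωⁱ≡x = there (subst (_∈ applyUpTo (ω ^_) d) (trans (sym (^-% ωᵈ≡1 i)) ωⁱ≡x)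
                                    (∈-applyUpTo⁺ (ω ^_) (m%n<n i d)))

  period-of-repeat : ∀ {i j} → i < j → ω ^ i ≡ ω ^ j → ω ^ (j ∸ i) ≡ 1#
  period-of-repeat {i} {j} i<j ωⁱ≡ωʲ = *-cancelˡ (^≢0 i ω≢0) (begin
    ω ^ i * ω ^ (j ∸ i) ≡⟨ sym (^-homo-* ω i (j ∸ i)) ⟩
    ω ^ (i ℕ.+ (j ∸ i)) ≡⟨ cong (ω ^_) (ℕ.m+[n∸m]≡n (ℕ.<⇒≤ i<j)) ⟩
    ω ^ j               ≡⟨ sym ωⁱ≡ωʲ ⟩
    ω ^ i               ≡⟨ sym (*-identityʳ _) ⟩
    ω ^ i * 1#          ∎)
    where open ≡-Reasoning

  private
    ≡-of-index : ∀ {x y} → index (complete x) ≡ index (complete y) → x ≡ y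
    ≡-of-index {x} {y} eq = trans (lookup-index (complete x))
      (trans (cong (lookup elements) eq) (sym (lookup-index (complete y))))

    zero-or-power : Fin (suc (length elements)) → Carrier
    zero-or-power zero    = 0#
    zero-or-power (suc i) = ω ^ toℕ i

  -- pigeonhole on 0, ω⁰, …, ω^(m-1): m + 1 elements of a field with m elements
  short-period : ∃ λ d → 0 < d × d ≤ N × ω ^ d ≡ 1#
  short-period with pigeonhole (ℕ.n<1+n (length elements)) (λ i → index (complete (zero-or-power i)))
  ... | zero  , suc j , _ , eq = ⊥-elim (^≢0 (toℕ j) ω≢0 (sym (≡-of-index eq)))
  ... | suc i , suc j , s≤s i<j , eq =
    toℕ j ∸ toℕ i , ℕ.m<n⇒0<n∸m i<j , j∸i≤N , period-of-repeat i<j (≡-of-index eq)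
    where
    j∸i≤N : toℕ j ∸ toℕ i ≤ N
    j∸i≤N = ℕ.≤-trans (ℕ.m∸n≤m (toℕ j) (toℕ i))
              (ℕ.≤-pred (subst (toℕ j <_) (trans card m≡1+N) (toℕ<n j)))

  ω^N≡1 : ω ^ N ≡ 1#
  ω^N≡1 with short-period
  ... | d , 0<d , d≤N , ωᵈ≡1 =
    subst (λ k → ω ^ k ≡ 1#) (ℕ.≤-antisym d≤N (N≤period d {{ℕ.>-nonZero 0<d}} ωᵈ≡1)) ωᵈ≡1

  N∣period : ∀ {j} → ω ^ j ≡ 1# → N ∣ j
  N∣period {j} ωʲ≡1 =
    m%n≡0⇒n∣m j N (remainder≡0 (j % N) (m%n<n j N) (trans (sym (^-% ω^N≡1 j)) ωʲ≡1))
    where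
    remainder≡0 : ∀ r → r < N → ω ^ r ≡ 1# → r ≡ 0
    remainder≡0 zero    _   _    = refl
    remainder≡0 (suc r) r<N ωʳ≡1 = ⊥-elim (ℕ.<⇒≱ r<N (N≤period (suc r) ωʳ≡1))

  ^N≡1 : ∀ {x} → x ≢ 0# → x ^ N ≡ 1#
  ^N≡1 {x} x≢0 with ω-primitive x x≢0
  ... | i , refl = trans (^-comm ω i N) (trans (cong (_^ i) ω^N≡1) (1^ i))

  ^m≡id : ∀ x → x ^ m ≡ x
  ^m≡id x = trans (cong (x ^_) m≡1+N) (x^1+N≡x (x ≟ 0#))
    where
    x^1+N≡x : Dec (x ≡ 0#) → x * x ^ N ≡ x
    x^1+N≡x (yes x≡0) = trans (cong (_* x ^ N) x≡0) (trans (zeroˡ _) (sym x≡0))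
    x^1+N≡x (no x≢0)  = trans (cong (x *_) (^N≡1 x≢0)) (*-identityʳ x)

  characteristic-two : ∀ {h} → m ≡ 2 ℕ.* h → 1# + 1# ≡ 0#
  characteristic-two {h} m≡2h = trans (cong (1# +_) (sym -1≡1)) (-‿inverseʳ 1#)
    where
    open ≡-Reasoning
    open RingProperties ring using (-1*x≈-x; -‿involutive)
    -1≡1 : - 1# ≡ 1#
    -1≡1 = begin
      - 1#                  ≡⟨ sym (^m≡id (- 1#)) ⟩
      (- 1#) ^ m            ≡⟨ cong ((- 1#) ^_) m≡2h ⟩
      (- 1#) ^ (2 ℕ.* h)    ≡⟨ sym (^-assocʳ (- 1#) 2 h) ⟩
      ((- 1#) ^ 2) ^ h      ≡⟨ cong (λ y → (- 1# * y) ^ h) (*-identityʳ (- 1#)) ⟩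
      (- 1# * - 1#) ^ h     ≡⟨ cong (_^ h) (trans (-1*x≈-x (- 1#)) (-‿involutive 1#)) ⟩
      1# ^ h                ≡⟨ 1^ h ⟩
      1#                    ∎

  ^f≡1⇒power-of-ωᵉ : ∀ {e f z} .{{_ : ℕ.NonZero f}} → e ℕ.* f ≡ N → z ^ f ≡ 1# →
                     ∃ λ c → (ω ^ e) ^ c ≡ z
  ^f≡1⇒power-of-ωᵉ {e} {f} {z} ef≡N zᶠ≡1 with ω-primitive z z≢0
    where
    z≢0 : z ≢ 0#
    z≢0 z≡0 = 0≢1 (trans (sym (0^ f)) (trans (cong (_^ f) (sym z≡0)) zᶠ≡1))
  ... | i , refl = quotient e∣i , (begin
    (ω ^ e) ^ quotient e∣i   ≡⟨ ^-assocʳ ω e (quotient e∣i) ⟩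
    ω ^ (e ℕ.* quotient e∣i) ≡⟨ cong (ω ^_) (sym (m∣n⇒n≡m*quotient e∣i)) ⟩
    ω ^ i                    ∎)
    where
    open ≡-Reasoning
    e∣i : e ∣ i
    e∣i = *-cancelʳ-∣ f (subst (_∣ i ℕ.* f) (sym ef≡N)
                         (N∣period (trans (sym (^-assocʳ ω i f)) zᶠ≡1)))

  inClass⇔ : ∀ {e f} .{{_ : ℕ.NonZero f}} → e ℕ.* f ≡ N → ∀ a x →
             T (inClass ω e a x) ⇔ x ^ f ≡ ω ^ (a ℕ.* f)
  inClass⇔ {e} {f} ef≡N a x = mk⇔ to from
    where
    open ≡-Reasoning
    to : T (inClass ω e a x) → x ^ f ≡ ω ^ (a ℕ.* f)
    to t with satisfied (any⁻ _ (upTo N) t)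
    ... | j , ωᵃωᵉʲ≡x = begin
      x ^ f                              ≡⟨ cong (_^ f) (sym (≟-sound ωᵃωᵉʲ≡x)) ⟩
      (ω ^ a * (ω ^ e) ^ j) ^ f          ≡⟨ ^-distrib-* (ω ^ a) ((ω ^ e) ^ j) f ⟩
      (ω ^ a) ^ f * ((ω ^ e) ^ j) ^ f    ≡⟨ cong₂ _*_ (^-assocʳ ω a f) (^-comm (ω ^ e) j f) ⟩
      ω ^ (a ℕ.* f) * ((ω ^ e) ^ f) ^ j  ≡⟨ cong (λ y → ω ^ (a ℕ.* f) * y ^ j) ωᵉᶠ≡1 ⟩
      ω ^ (a ℕ.* f) * 1# ^ j             ≡⟨ cong (ω ^ (a ℕ.* f) *_) (1^ j) ⟩
      ω ^ (a ℕ.* f) * 1#                 ≡⟨ *-identityʳ _ ⟩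
      ω ^ (a ℕ.* f)                      ∎
      where
      ωᵉᶠ≡1 : (ω ^ e) ^ f ≡ 1#
      ωᵉᶠ≡1 = trans (^-assocʳ ω e f) (trans (cong (ω ^_) ef≡N) ω^N≡1)

    from : x ^ f ≡ ω ^ (a ℕ.* f) → T (inClass ω e a x)
    from xᶠ≡ωᵃᶠ with ^f≡1⇒power-of-ωᵉ {e} ef≡N zᶠ≡1
      where
      z = x * (ω ^ a) ⁻¹
      zᶠ≡1 : z ^ f ≡ 1#
      zᶠ≡1 = begin
        (x * (ω ^ a) ⁻¹) ^ f                ≡⟨ ^-distrib-* x ((ω ^ a) ⁻¹) f ⟩
        x ^ f * ((ω ^ a) ⁻¹) ^ f            ≡⟨ cong₂ _*_ xᶠ≡ωᵃᶠ (^-⁻¹ f (^≢0 a ω≢0)) ⟩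
        ω ^ (a ℕ.* f) * ((ω ^ a) ^ f) ⁻¹    ≡⟨ cong (λ y → ω ^ (a ℕ.* f) * y ⁻¹) (^-assocʳ ω a f) ⟩
        ω ^ (a ℕ.* f) * (ω ^ (a ℕ.* f)) ⁻¹  ≡⟨ ⁻¹-inverse _ (^≢0 (a ℕ.* f) ω≢0) ⟩
        1#                                  ∎
    ... | c , ωᵉᶜ≡z = any⁺ _ (lose (∈-upTo⁺ (m%n<n c N)) (≟-complete (begin
      ω ^ a * (ω ^ e) ^ (c % N)  ≡⟨ cong (ω ^ a *_) (sym (^-% {d = N} (^N≡1 (^≢0 e ω≢0)) c)) ⟩
      ω ^ a * (ω ^ e) ^ c        ≡⟨ cong (ω ^ a *_) ωᵉᶜ≡z ⟩
      ω ^ a * (x * (ω ^ a) ⁻¹)   ≡⟨ *-/-cancelˡ x (^≢0 a ω≢0) ⟩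
      x                          ∎)))

module CharacteristicTwo {m : ℕ} (K : FiniteField m)
                         (1+1≡0 : FiniteField._+_ K (FiniteField.1# K) (FiniteField.1# K) ≡ FiniteField.0# K) where
  open FiniteField K
  open FieldProperties K
  open ≡-Reasoning

  x+x≡0 : ∀ x → x + x ≡ 0#
  x+x≡0 x = begin
    x + x          ≡⟨ solve 1 (λ x → x :+ x := (con 1 :+ con 1) :* x) refl x ⟩
    (1# + 1#) * x  ≡⟨ cong (_* x) 1+1≡0 ⟩
    0# * x         ≡⟨ zeroˡ x ⟩
    0#             ∎

  x+y≡z⇒x≡z+y : ∀ {x y z} → x + y ≡ z → x ≡ z + y
  x+y≡z⇒x≡z+y {x} {y} {z} x+y≡z = begin
    x            ≡⟨ sym (+-identityʳ x) ⟩
    x + 0#       ≡⟨ cong (x +_) (sym (x+x≡0 y)) ⟩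
    x + (y + y)  ≡⟨ sym (+-assoc x y y) ⟩
    (x + y) + y  ≡⟨ cong (_+ y) x+y≡z ⟩
    z + y        ∎

  x+y≡0⇒x≡y : ∀ {x y} → x + y ≡ 0# → x ≡ y
  x+y≡0⇒x≡y {x} {y} x+y≡0 = trans (x+y≡z⇒x≡z+y x+y≡0) (+-identityˡ y)

  [x+y]² : ∀ x y → (x + y) * (x + y) ≡ x * x + y * y
  [x+y]² x y = begin
    (x + y) * (x + y)                ≡⟨ solve 2 (λ x y → (x :+ y) :* (x :+ y)
                                          := x :* x :+ y :* y :+ (x :* y :+ x :* y)) refl x y ⟩
    x * x + y * y + (x * y + x * y)  ≡⟨ cong (x * x + y * y +_) (x+x≡0 (x * y)) ⟩
    x * x + y * y + 0#               ≡⟨ +-identityʳ _ ⟩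
    x * x + y * y                    ∎

  [x+1]²+[x+1] : ∀ x → (x + 1#) * (x + 1#) + (x + 1#) ≡ x * x + x
  [x+1]²+[x+1] x = begin
    (x + 1#) * (x + 1#) + (x + 1#)     ≡⟨ solve 1 (λ x → (x :+ con 1) :* (x :+ con 1) :+ (x :+ con 1)
                                            := (x :* x :+ x) :+ (x :+ x) :+ (con 1 :+ con 1)) refl x ⟩
    (x * x + x) + (x + x) + (1# + 1#)  ≡⟨ cong₂ (λ u v → (x * x + x) + u + v) (x+x≡0 x) 1+1≡0 ⟩
    (x * x + x) + 0# + 0#              ≡⟨ trans (+-identityʳ _) (+-identityʳ _) ⟩
    x * x + x                          ∎

  x²≡y²⇒x≡y : ∀ {x y} → x * x ≡ y * y → x ≡ y
  x²≡y²⇒x≡y {x} {y} x²≡y² = x+y≡0⇒x≡y ([ id , id ] (x*y≡0⇒x≡0⊎y≡0 (begin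
    (x + y) * (x + y) ≡⟨ [x+y]² x y ⟩
    x * x + y * y     ≡⟨ cong (_+ y * y) x²≡y² ⟩
    y * y + y * y     ≡⟨ x+x≡0 (y * y) ⟩
    0#                ∎)))

  x²+x≡y²+y⇒x≡y⊎x≡y+1 : ∀ {x y} → x * x + x ≡ y * y + y → x ≡ y ⊎ x ≡ y + 1#
  x²+x≡y²+y⇒x≡y⊎x≡y+1 {x} {y} eq =
    Sum.map x+y≡0⇒x≡y (x+y≡0⇒x≡y ∘ trans (sym (+-assoc x y 1#))) (x*y≡0⇒x≡0⊎y≡0 (begin
      (x + y) * (x + y + 1#)       ≡⟨ solve 2 (λ x y → (x :+ y) :* (x :+ y :+ con 1)
                                        := (x :+ y) :* (x :+ y) :+ (x :+ y)) refl x y ⟩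
      (x + y) * (x + y) + (x + y)  ≡⟨ cong (_+ (x + y)) ([x+y]² x y) ⟩
      x * x + y * y + (x + y)      ≡⟨ solve 2 (λ x y → x :* x :+ y :* y :+ (x :+ y)
                                        := (x :* x :+ x) :+ (y :* y :+ y)) refl x y ⟩
      (x * x + x) + (y * y + y)    ≡⟨ cong (_+ (y * y + y)) eq ⟩
      (y * y + y) + (y * y + y)    ≡⟨ x+x≡0 (y * y + y) ⟩
      0#                           ∎))

  ^2^suc : ∀ x k → x ^ (2 ℕ.^ suc k) ≡ x ^ (2 ℕ.^ k) * x ^ (2 ℕ.^ k)
  ^2^suc x k = trans (cong (λ i → x ^ (2 ℕ.^ k ℕ.+ i)) (ℕ.+-identityʳ (2 ℕ.^ k)))
                     (^-homo-* x (2 ℕ.^ k) (2 ℕ.^ k))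

  frobenius : ∀ k x y → (x + y) ^ (2 ℕ.^ k) ≡ x ^ (2 ℕ.^ k) + y ^ (2 ℕ.^ k)
  frobenius zero    x y = trans (*-identityʳ (x + y)) (sym (cong₂ _+_ (*-identityʳ x) (*-identityʳ y)))
  frobenius (suc k) x y = begin
    (x + y) ^ (2 ℕ.^ suc k)                    ≡⟨ ^2^suc (x + y) k ⟩
    (x + y) ^ (2 ℕ.^ k) * (x + y) ^ (2 ℕ.^ k)  ≡⟨ cong (λ z → z * z) (frobenius k x y) ⟩
    (a + b) * (a + b)                          ≡⟨ [x+y]² a b ⟩
    a * a + b * b                              ≡⟨ sym (cong₂ _+_ (^2^suc x k) (^2^suc y k)) ⟩
    x ^ (2 ℕ.^ suc k) + y ^ (2 ℕ.^ suc k)      ∎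
    where
    a = x ^ (2 ℕ.^ k)
    b = y ^ (2 ℕ.^ k)

  trace-homo-+ : ∀ i u v → trace i (u + v) ≡ trace i u + trace i v
  trace-homo-+ zero    u v = sym (+-identityʳ 0#)
  trace-homo-+ (suc i) u v = begin
    trace i (u + v) + (u + v) ^ (2 ℕ.^ i)
      ≡⟨ cong₂ _+_ (trace-homo-+ i u v) (frobenius i u v) ⟩
    (trace i u + trace i v) + (u ^ (2 ℕ.^ i) + v ^ (2 ℕ.^ i))
      ≡⟨ solve 4 (λ a b c d → (a :+ b) :+ (c :+ d) := (a :+ c) :+ (b :+ d)) refl _ _ _ _ ⟩
    trace (suc i) u + trace (suc i) v
      ∎

  trace-^ : ∀ i k u → trace i u ^ (2 ℕ.^ k) ≡ trace i (u ^ (2 ℕ.^ k))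
  trace-^ zero    k u = 0^ (2 ℕ.^ k) {{ℕ.m^n≢0 2 k}}
  trace-^ (suc i) k u = begin
    (trace i u + u ^ (2 ℕ.^ i)) ^ (2 ℕ.^ k)
      ≡⟨ frobenius k (trace i u) (u ^ (2 ℕ.^ i)) ⟩
    trace i u ^ (2 ℕ.^ k) + (u ^ (2 ℕ.^ i)) ^ (2 ℕ.^ k)
      ≡⟨ cong₂ _+_ (trace-^ i k u) (^-comm u (2 ℕ.^ i) (2 ℕ.^ k)) ⟩
    trace (suc i) (u ^ (2 ℕ.^ k))
      ∎

  trace-+ : ∀ j i u → trace (j ℕ.+ i) u ≡ trace i u + trace j u ^ (2 ℕ.^ i)
  trace-+ zero    i u = sym (trans (cong (trace i u +_) (0^ (2 ℕ.^ i) {{ℕ.m^n≢0 2 i}})) (+-identityʳ _))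
  trace-+ (suc j) i u = begin
    trace (j ℕ.+ i) u + u ^ (2 ℕ.^ (j ℕ.+ i))
      ≡⟨ cong₂ _+_ (trace-+ j i u) uʲ⁺ⁱ ⟩
    trace i u + trace j u ^ (2 ℕ.^ i) + (u ^ (2 ℕ.^ j)) ^ (2 ℕ.^ i)
      ≡⟨ +-assoc _ _ _ ⟩
    trace i u + (trace j u ^ (2 ℕ.^ i) + (u ^ (2 ℕ.^ j)) ^ (2 ℕ.^ i))
      ≡⟨ cong (trace i u +_) (sym (frobenius i _ _)) ⟩
    trace i u + trace (suc j) u ^ (2 ℕ.^ i)
      ∎
    where
    uʲ⁺ⁱ : u ^ (2 ℕ.^ (j ℕ.+ i)) ≡ (u ^ (2 ℕ.^ j)) ^ (2 ℕ.^ i)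
    uʲ⁺ⁱ = trans (cong (u ^_) (ℕ.^-distribˡ-+-* 2 j i)) (sym (^-assocʳ u (2 ℕ.^ j) (2 ℕ.^ i)))

  trace² : ∀ i u → trace i u * trace i u ≡ trace (suc i) u + u
  trace² zero    u = begin
    0# * 0#        ≡⟨ zeroˡ 0# ⟩
    0#             ≡⟨ sym (x+x≡0 u) ⟩
    u + u          ≡⟨ cong (_+ u) (sym (trans (+-identityˡ _) (*-identityʳ u))) ⟩
    trace 1 u + u  ∎
  trace² (suc i) u = begin
    (t + w) * (t + w)  ≡⟨ [x+y]² t w ⟩
    t * t + w * w      ≡⟨ cong₂ _+_ (trace² i u) (sym (^2^suc u i)) ⟩
    (t + w + u) + w′   ≡⟨ solve 4 (λ t w u v → t :+ w :+ u :+ v := t :+ w :+ v :+ u) refl t w u w′ ⟩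
    (t + w + w′) + u   ∎
    where
    t  = trace i u
    w  = u ^ (2 ℕ.^ i)
    w′ = u ^ (2 ℕ.^ suc i)

  trace-x²+x : ∀ i x → trace i (x * x + x) ≡ x ^ (2 ℕ.^ i) + x
  trace-x²+x zero    x = sym (trans (cong (_+ x) (*-identityʳ x)) (x+x≡0 x))
  trace-x²+x (suc i) x = begin
    trace i (x * x + x) + (x * x + x) ^ (2 ℕ.^ i)
      ≡⟨ cong₂ _+_ (trace-x²+x i x) (frobenius i (x * x) x) ⟩
    (a + x) + ((x * x) ^ (2 ℕ.^ i) + a)
      ≡⟨ cong (λ t → (a + x) + (t + a)) (trans (^-distrib-* x x (2 ℕ.^ i)) (sym (^2^suc x i))) ⟩
    (a + x) + (b + a)
      ≡⟨ solve 3 (λ a x b → (a :+ x) :+ (b :+ a) := (b :+ x) :+ (a :+ a)) refl a x b ⟩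
    (b + x) + (a + a)
      ≡⟨ cong ((b + x) +_) (x+x≡0 a) ⟩
    (b + x) + 0#
      ≡⟨ +-identityʳ _ ⟩
    b + x
      ∎
    where
    a = x ^ (2 ℕ.^ i)
    b = x ^ (2 ℕ.^ suc i)

  -- the classical explicit root of y² + y = γ built from some θ of trace 1 (additive Hilbert 90)
  artinSchreierRoot : ℕ → Carrier → Carrier → Carrier
  artinSchreierRoot zero    θ γ = 0#
  artinSchreierRoot (suc j) θ γ = artinSchreierRoot j θ γ + trace j θ * γ ^ (2 ℕ.^ j)

  artinSchreierRoot-invariant : ∀ j θ γ → let y = artinSchreierRoot j θ γ in
    y * y + y ≡ trace j θ * γ ^ (2 ℕ.^ j) + θ * (trace j γ * trace j γ)
  artinSchreierRoot-invariant zero    θ γ =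
    solve 2 (λ g θ → con 0 :* con 0 :+ con 0 := con 0 :* g :+ θ :* (con 0 :* con 0)) refl (γ ^ 1) θ
  artinSchreierRoot-invariant (suc j) θ γ = begin
    (y + t * g) * (y + t * g) + (y + t * g)
      ≡⟨ cong (_+ (y + t * g)) ([x+y]² y (t * g)) ⟩
    y * y + (t * g) * (t * g) + (y + t * g)
      ≡⟨ solve 3 (λ y t g → y :* y :+ (t :* g) :* (t :* g) :+ (y :+ t :* g)
                         := (y :* y :+ y) :+ ((t :* t) :* (g :* g) :+ t :* g)) refl y t g ⟩
    (y * y + y) + ((t * t) * (g * g) + t * g)
      ≡⟨ cong₂ (λ u v → u + (v + t * g)) (artinSchreierRoot-invariant j θ γ)
                                          (cong₂ _*_ (trace² j θ) (sym (^2^suc γ j))) ⟩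
    (t * g + θ * (s * s)) + ((t′ + θ) * g′ + t * g)
      ≡⟨ solve 6 (λ t g θ s t′ g′ → (t :* g :+ θ :* s) :+ ((t′ :+ θ) :* g′ :+ t :* g)
                                 := (t′ :* g′ :+ θ :* (s :+ g′)) :+ (t :* g :+ t :* g))
                 refl t g θ (s * s) t′ g′ ⟩
    (t′ * g′ + θ * (s * s + g′)) + (t * g + t * g)
      ≡⟨ cong₂ (λ z w → (t′ * g′ + θ * z) + w) (sym s′²) (x+x≡0 (t * g)) ⟩
    (t′ * g′ + θ * (trace (suc j) γ * trace (suc j) γ)) + 0#
      ≡⟨ +-identityʳ _ ⟩
    t′ * g′ + θ * (trace (suc j) γ * trace (suc j) γ)
      ∎
    where
    y  = artinSchreierRoot j θ γ
    t  = trace j θ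
    t′ = trace (suc j) θ
    s  = trace j γ
    g  = γ ^ (2 ℕ.^ j)
    g′ = γ ^ (2 ℕ.^ suc j)
    s′² : trace (suc j) γ * trace (suc j) γ ≡ s * s + g′
    s′² = trans ([x+y]² s g) (cong (s * s +_) (sym (^2^suc γ j)))

  artinSchreierRoot-solves : ∀ k θ γ → trace k θ ≡ 1# → trace k γ ≡ 0# → γ ^ (2 ℕ.^ k) ≡ γ →
    let y = artinSchreierRoot k θ γ in y * y + y ≡ γ
  artinSchreierRoot-solves k θ γ trθ≡1 trγ≡0 γ^2^k≡γ = begin
    y * y + y
      ≡⟨ artinSchreierRoot-invariant k θ γ ⟩
    trace k θ * γ ^ (2 ℕ.^ k) + θ * (trace k γ * trace k γ)
      ≡⟨ cong₂ (λ a b → a * γ ^ (2 ℕ.^ k) + θ * (b * b)) trθ≡1 trγ≡0 ⟩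
    1# * γ ^ (2 ℕ.^ k) + θ * (0# * 0#)
      ≡⟨ cong₂ _+_ (trans (*-identityˡ _) γ^2^k≡γ) (trans (cong (θ *_) (zeroˡ 0#)) (zeroʳ θ)) ⟩
    γ + 0#
      ≡⟨ +-identityʳ γ ⟩
    γ
      ∎
    where
    y = artinSchreierRoot k θ γ

module QuadraticExtension (n : ℕ) .{{_ : ℕ.NonZero n}} (K : FiniteField (2 ℕ.^ n ℕ.* 2 ℕ.^ n))
                          {ω : FiniteField.Carrier K} (ω-primitive : FiniteField.IsPrimitive K ω) where
  open FiniteField K
  open FieldProperties K
  open RingProperties ring using (+-cancelˡ)
  open ≡-Reasoning

  Q : ℕ
  Q = 2 ℕ.^ n

  2≤Q : 2 ≤ Q
  2≤Q = ℕ.^-monoʳ-≤ 2 (ℕ.>-nonZero⁻¹ n)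

  open PrimitiveElement K ω-primitive (ℕ.<-≤-trans (s≤s (s≤s (s≤s z≤n))) (ℕ.*-mono-≤ 2≤Q 2≤Q))

  Q*Q≡2*[2^[n-1]*Q] : Q ℕ.* Q ≡ 2 ℕ.* (2 ℕ.^ pred n ℕ.* Q)
  Q*Q≡2*[2^[n-1]*Q] =
    trans (cong (λ k → 2 ℕ.^ k ℕ.* Q) (sym (ℕ.suc-pred n))) (ℕ.*-assoc 2 (2 ℕ.^ pred n) Q)

  open CharacteristicTwo K (characteristic-two {2 ℕ.^ pred n ℕ.* Q} Q*Q≡2*[2^[n-1]*Q])

  InSubfield : Carrier → Set
  InSubfield x = x ^ Q ≡ x

  norm relTrace : Carrier → Carrier
  norm     x = x ^ Q * x
  relTrace x = x ^ Q + x

  ^Q-involutive : ∀ x → (x ^ Q) ^ Q ≡ x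
  ^Q-involutive x = trans (^-assocʳ x Q Q) (^m≡id x)

  norm-∈ : ∀ x → InSubfield (norm x)
  norm-∈ x = trans (^-distrib-* (x ^ Q) x Q) (trans (cong (_* x ^ Q) (^Q-involutive x)) (*-comm x (x ^ Q)))

  relTrace-∈ : ∀ x → InSubfield (relTrace x)
  relTrace-∈ x = trans (frobenius n (x ^ Q) x) (trans (cong (_+ x ^ Q) (^Q-involutive x)) (+-comm x (x ^ Q)))

  1-∈ : InSubfield 1#
  1-∈ = 1^ Q

  +-∈ : ∀ {x y} → InSubfield x → InSubfield y → InSubfield (x + y)
  +-∈ {x} {y} x∈ y∈ = trans (frobenius n x y) (cong₂ _+_ x∈ y∈)

  *-∈ : ∀ {x y} → InSubfield x → InSubfield y → InSubfield (x * y)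
  *-∈ {x} {y} x∈ y∈ = trans (^-distrib-* x y Q) (cong₂ _*_ x∈ y∈)

  ^-∈ : ∀ {x} k → InSubfield x → InSubfield (x ^ k)
  ^-∈ {x} k x∈ = trans (^-comm x k Q) (cong (_^ k) x∈)

  ⁻¹-∈ : ∀ {x} → x ≢ 0# → InSubfield x → InSubfield (x ⁻¹)
  ⁻¹-∈ {x} x≢0 x∈ = trans (^-⁻¹ Q x≢0) (cong _⁻¹ x∈)

  relTrace-scale : ∀ {c} y → InSubfield c → relTrace (c * y) ≡ c * relTrace y
  relTrace-scale {c} y c∈ = begin
    (c * y) ^ Q + c * y  ≡⟨ cong (_+ c * y) (trans (^-distrib-* c y Q) (cong (_* y ^ Q) c∈)) ⟩
    c * y ^ Q + c * y    ≡⟨ sym (distribˡ c (y ^ Q) y) ⟩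
    c * (y ^ Q + y)      ∎

  norm-scale : ∀ {c} y → InSubfield c → norm (c * y) ≡ (c * c) * norm y
  norm-scale {c} y c∈ = begin
    (c * y) ^ Q * (c * y)  ≡⟨ cong (_* (c * y)) (trans (^-distrib-* c y Q) (cong (_* y ^ Q) c∈)) ⟩
    c * y ^ Q * (c * y)    ≡⟨ solve 3 (λ c z y → c :* z :* (c :* y) := c :* c :* (z :* y)) refl c (y ^ Q) y ⟩
    (c * c) * (y ^ Q * y)  ∎

  norm-+1 : ∀ x → norm (x + 1#) ≡ norm x + relTrace x + 1#
  norm-+1 x = begin
    (x + 1#) ^ Q * (x + 1#)       ≡⟨ cong (_* (x + 1#)) (trans (frobenius n x 1#) (cong (x ^ Q +_) (1^ Q))) ⟩
    (x ^ Q + 1#) * (x + 1#)       ≡⟨ solve 2 (λ x′ x → (x′ :+ con 1) :* (x :+ con 1)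
                                         := x′ :* x :+ (x′ :+ x) :+ con 1) refl (x ^ Q) x ⟩
    x ^ Q * x + (x ^ Q + x) + 1#  ∎

  norm≡x²+x : ∀ {y} → relTrace y ≡ 1# → norm y ≡ y * y + y
  norm≡x²+x {y} try≡1 = begin
    y ^ Q * y     ≡⟨ cong (_* y) (x+y≡z⇒x≡z+y try≡1) ⟩
    (1# + y) * y  ≡⟨ solve 1 (λ y → (con 1 :+ y) :* y := y :* y :+ y) refl y ⟩
    y * y + y     ∎

  trace-tower : ∀ u → trace (n ℕ.+ n) u ≡ trace n (relTrace u)
  trace-tower u = begin
    trace (n ℕ.+ n) u            ≡⟨ trace-+ n n u ⟩
    trace n u + trace n u ^ Q    ≡⟨ cong (trace n u +_) (trace-^ n n u) ⟩
    trace n u + trace n (u ^ Q)  ≡⟨ +-comm _ _ ⟩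
    trace n (u ^ Q) + trace n u  ≡⟨ sym (trace-homo-+ n (u ^ Q) u) ⟩
    trace n (relTrace u)         ∎

  relTrace-ω≢0 : relTrace ω ≢ 0#
  relTrace-ω≢0 ωᵠ+ω≡0 = ℕ.<⇒≱ Q∸1<N (∣⇒≤ {{ℕ.>-nonZero 0<Q∸1}} (N∣period ω^[Q∸1]≡1))
    where
    1<Q = ℕ.<-≤-trans (s≤s (s≤s z≤n)) 2≤Q
    0<Q∸1 = ℕ.m<n⇒0<n∸m 1<Q
    Q∸1<N : Q ∸ 1 < N
    Q∸1<N = ℕ.∸-monoˡ-< (ℕ.m<m*n Q Q {{ℕ.m^n≢0 2 n}} 1<Q) (ℕ.<⇒≤ 1<Q)
    ω^[Q∸1]≡1 : ω ^ (Q ∸ 1) ≡ 1#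
    ω^[Q∸1]≡1 = *-cancelˡ ω≢0 (begin
      ω * ω ^ (Q ∸ 1)  ≡⟨ cong (ω ^_) (ℕ.suc-pred Q {{ℕ.>-nonZero (ℕ.<-trans (s≤s z≤n) 1<Q)}}) ⟩
      ω ^ Q            ≡⟨ x+y≡0⇒x≡y ωᵠ+ω≡0 ⟩
      ω                ≡⟨ sym (*-identityʳ ω) ⟩
      ω * 1#           ∎)

  ∃relTrace≡1 : ∃ λ η → relTrace η ≡ 1#
  ∃relTrace≡1 = relTrace ω ⁻¹ * ω , (begin
    relTrace (relTrace ω ⁻¹ * ω)  ≡⟨ relTrace-scale ω (⁻¹-∈ relTrace-ω≢0 (relTrace-∈ ω)) ⟩
    relTrace ω ⁻¹ * relTrace ω    ≡⟨ ⁻¹-inverseˡ relTrace-ω≢0 ⟩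
    1#                            ∎)

  -- θ = γ η has absolute trace Tr_n(γ) = 1 in F_{Q²}, while γ ∈ F_Q has absolute trace 0 there.
  ∃x²+x≡ : ∀ {γ} → InSubfield γ → trace n γ ≡ 1# → ∃ λ y → y * y + y ≡ γ
  ∃x²+x≡ {γ} γ∈ trγ≡1 with ∃relTrace≡1
  ... | η , trη≡1 = artinSchreierRoot (n ℕ.+ n) (γ * η) γ ,
                    artinSchreierRoot-solves (n ℕ.+ n) (γ * η) γ trγη≡1 trγ≡0 γ^2^[n+n]≡γ
    where
    trγη≡1 : trace (n ℕ.+ n) (γ * η) ≡ 1#
    trγη≡1 = begin
      trace (n ℕ.+ n) (γ * η)     ≡⟨ trace-tower (γ * η) ⟩
      trace n (relTrace (γ * η))  ≡⟨ cong (trace n) (relTrace-scale η γ∈) ⟩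
      trace n (γ * relTrace η)    ≡⟨ cong (λ z → trace n (γ * z)) trη≡1 ⟩
      trace n (γ * 1#)            ≡⟨ cong (trace n) (*-identityʳ γ) ⟩
      trace n γ                   ≡⟨ trγ≡1 ⟩
      1#                          ∎
    trγ≡0 : trace (n ℕ.+ n) γ ≡ 0#
    trγ≡0 = begin
      trace (n ℕ.+ n) γ      ≡⟨ trace-tower γ ⟩
      trace n (γ ^ Q + γ)    ≡⟨ cong (λ z → trace n (z + γ)) γ∈ ⟩
      trace n (γ + γ)        ≡⟨ trace-homo-+ n γ γ ⟩
      trace n γ + trace n γ  ≡⟨ x+x≡0 (trace n γ) ⟩
      0#                     ∎
    γ^2^[n+n]≡γ : γ ^ (2 ℕ.^ (n ℕ.+ n)) ≡ γ
    γ^2^[n+n]≡γ = trans (cong (γ ^_) (ℕ.^-distribˡ-+-* 2 n n)) (^m≡id γ)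

  HasNormAndTrace : Carrier → Carrier → Carrier → Set
  HasNormAndTrace A c x = norm x ≡ A × relTrace x ≡ c

  √ : Carrier → Carrier
  √ A = A ^ (2 ℕ.^ pred n)

  √²≡ : ∀ {A} → InSubfield A → √ A * √ A ≡ A
  √²≡ {A} A∈ = trans (sym (^2^suc A (pred n))) (trans (cong (λ k → A ^ (2 ℕ.^ k)) (ℕ.suc-pred n)) A∈)

  HasNormAndTrace-0⇔ : ∀ {A} → InSubfield A → ∀ x → HasNormAndTrace A 0# x ⇔ x ≡ √ A
  HasNormAndTrace-0⇔ {A} A∈ x = mk⇔ to from
    where
    to : HasNormAndTrace A 0# x → x ≡ √ A
    to (normx≡A , trx≡0) = x²≡y²⇒x≡y (begin
      x * x      ≡⟨ cong (_* x) (sym (x+y≡0⇒x≡y trx≡0)) ⟩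
      x ^ Q * x  ≡⟨ normx≡A ⟩
      A          ≡⟨ sym (√²≡ A∈) ⟩
      √ A * √ A  ∎)
    from : x ≡ √ A → HasNormAndTrace A 0# x
    from refl = trans (cong (_* √ A) √A∈) (√²≡ A∈) , trans (cong (_+ √ A) √A∈) (x+x≡0 (√ A))
      where
      √A∈ : InSubfield (√ A)
      √A∈ = ^-∈ (2 ℕ.^ pred n) A∈

  HasNormAndTrace-scaled⇔ : ∀ {A c} → InSubfield A → InSubfield c → c ≢ 0# → ∀ y →
    HasNormAndTrace A c (c * y) ⇔ (trace n (A / (c ^ 2)) ≡ 1# × y * y + y ≡ A / (c ^ 2))
  HasNormAndTrace-scaled⇔ {A} {c} A∈ c∈ c≢0 y = mk⇔ to from
    where
    γ = A / (c ^ 2)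
    c²γ≡A : (c * c) * γ ≡ A
    c²γ≡A = trans (cong (_* γ) (cong (c *_) (sym (*-identityʳ c)))) (*-/-cancelˡ A (^≢0 2 c≢0))

    y²+y≡γ⇒relTrace≡trace : y * y + y ≡ γ → relTrace y ≡ trace n γ
    y²+y≡γ⇒relTrace≡trace y²+y≡γ = trans (sym (trace-x²+x n y)) (cong (trace n) y²+y≡γ)

    to : HasNormAndTrace A c (c * y) → trace n γ ≡ 1# × y * y + y ≡ γ
    to (norm≡A , tr≡c) = trans (sym (y²+y≡γ⇒relTrace≡trace y²+y≡γ)) try≡1 , y²+y≡γ
      where
      try≡1 : relTrace y ≡ 1#
      try≡1 = *-cancelˡ c≢0 (trans (sym (relTrace-scale y c∈)) (trans tr≡c (sym (*-identityʳ c))))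
      y²+y≡γ : y * y + y ≡ γ
      y²+y≡γ = *-cancelˡ (*≢0 c≢0 c≢0) (begin
        (c * c) * (y * y + y)  ≡⟨ cong ((c * c) *_) (sym (norm≡x²+x try≡1)) ⟩
        (c * c) * norm y       ≡⟨ sym (norm-scale y c∈) ⟩
        norm (c * y)           ≡⟨ norm≡A ⟩
        A                      ≡⟨ sym c²γ≡A ⟩
        (c * c) * γ            ∎)

    from : trace n γ ≡ 1# × y * y + y ≡ γ → HasNormAndTrace A c (c * y)
    from (trγ≡1 , y²+y≡γ) = norm≡A , tr≡c
      where
      try≡1 : relTrace y ≡ 1#
      try≡1 = trans (y²+y≡γ⇒relTrace≡trace y²+y≡γ) trγ≡1
      norm≡A : norm (c * y) ≡ A
      norm≡A = begin
        norm (c * y)      ≡⟨ norm-scale y c∈ ⟩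
        (c * c) * norm y  ≡⟨ cong ((c * c) *_) (trans (norm≡x²+x try≡1) y²+y≡γ) ⟩
        (c * c) * γ       ≡⟨ c²γ≡A ⟩
        A                 ∎
      tr≡c : relTrace (c * y) ≡ c
      tr≡c = trans (relTrace-scale y c∈) (trans (cong (c *_) try≡1) (*-identityʳ c))

  ∈C⇔ : ∀ a x → T (inClass ω (Q ∸ 1) a x) ⇔ norm x ≡ ω ^ (a ℕ.* (Q ℕ.+ 1))
  ∈C⇔ a x = ⇔.trans (inClass⇔ {Q ∸ 1} {{ℕ.>-nonZero (ℕ.m≤n+m 1 Q)}} ([q∸1]*[q+1]≡q*q∸1 Q) a x)
                    (mk⇔ (trans (sym (^-suc x Q))) (trans (^-suc x Q)))

  module Cyclotomic (a b : ℕ) where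
    A B c : Carrier
    A = ω ^ (a ℕ.* (Q ℕ.+ 1))
    B = ω ^ (b ℕ.* (Q ℕ.+ 1))
    c = cValue K ω n a b

    power-∈ : ∀ k → InSubfield (ω ^ (k ℕ.* (Q ℕ.+ 1)))
    power-∈ k = subst InSubfield (trans (sym (^-suc (ω ^ k) Q)) (^-assocʳ ω k (Q ℕ.+ 1))) (norm-∈ (ω ^ k))

    c∈ : InSubfield c
    c∈ = +-∈ (+-∈ 1-∈ (power-∈ a)) (power-∈ b)

    pair⇔ : ∀ x → T (inClass ω (Q ∸ 1) a x ∧ inClass ω (Q ∸ 1) b (x + 1#)) ⇔ HasNormAndTrace A c x
    pair⇔ x = ⇔.trans T-∧ (mk⇔ to from)
      where
      to : T (inClass ω (Q ∸ 1) a x) × T (inClass ω (Q ∸ 1) b (x + 1#)) → HasNormAndTrace A c x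
      to (x∈Cₐ , x+1∈C_b) = normx≡A , trans (x+y≡z⇒x≡z+y (begin
        relTrace x + (1# + A)     ≡⟨ solve 3 (λ t o a → t :+ (o :+ a) := a :+ t :+ o) refl (relTrace x) 1# A ⟩
        A + relTrace x + 1#       ≡⟨ cong (λ z → z + relTrace x + 1#) (sym normx≡A) ⟩
        norm x + relTrace x + 1#  ≡⟨ sym (norm-+1 x) ⟩
        norm (x + 1#)             ≡⟨ Equivalence.to (∈C⇔ b (x + 1#)) x+1∈C_b ⟩
        B                         ∎)) (+-comm B (1# + A))
        where
        normx≡A = Equivalence.to (∈C⇔ a x) x∈Cₐ
      from : HasNormAndTrace A c x → T (inClass ω (Q ∸ 1) a x) × T (inClass ω (Q ∸ 1) b (x + 1#))
      from (normx≡A , trx≡c) = Equivalence.from (∈C⇔ a x) normx≡A , Equivalence.from (∈C⇔ b (x + 1#)) (begin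
        norm (x + 1#)             ≡⟨ norm-+1 x ⟩
        norm x + relTrace x + 1#  ≡⟨ cong₂ (λ u v → u + v + 1#) normx≡A trx≡c ⟩
        A + ((1# + A) + B) + 1#   ≡⟨ solve 3 (λ a b o → a :+ ((o :+ a) :+ b) :+ o
                                         := b :+ (a :+ a) :+ (o :+ o)) refl A B 1# ⟩
        B + (A + A) + (1# + 1#)   ≡⟨ cong₂ (λ u v → B + u + v) (x+x≡0 A) (x+x≡0 1#) ⟩
        B + 0# + 0#               ≡⟨ trans (+-identityʳ _) (+-identityʳ B) ⟩
        B                         ∎)

    cyclotomicNumber≡ : (S : List Carrier) → Unique S → (∀ x → HasNormAndTrace A c x ⇔ x ∈ S) →
                        cyclotomicNumber ω (Q ∸ 1) a b ≡ length S
    cyclotomicNumber≡ S S-unique solutions⇔ =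
      length-filterᵇ≡ _ S S-unique (λ x → ⇔.trans (pair⇔ x) (solutions⇔ x))

    c≡0⇒count≡1 : c ≡ 0# → cyclotomicNumber ω (Q ∸ 1) a b ≡ 1
    c≡0⇒count≡1 c≡0 = cyclotomicNumber≡ (√ A ∷ []) ([] ∷ []) λ x →
      subst (λ z → HasNormAndTrace A z x ⇔ x ∈ √ A ∷ []) (sym c≡0)
        (⇔.trans (HasNormAndTrace-0⇔ (power-∈ a) x)
                 (mk⇔ here λ { (here x≡√A) → x≡√A ; (there ()) }))

    module _ (c≢0 : c ≢ 0#) where
      γ : Carrier
      γ = A / (c ^ 2)

      scaled⇔ : ∀ y → HasNormAndTrace A c (c * y) ⇔ (trace n γ ≡ 1# × y * y + y ≡ γ)
      scaled⇔ = HasNormAndTrace-scaled⇔ (power-∈ a) c∈ c≢0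

      descale : ∀ {x} → HasNormAndTrace A c x →
                trace n γ ≡ 1# × (x * c ⁻¹) * (x * c ⁻¹) + x * c ⁻¹ ≡ γ
      descale {x} =
        Equivalence.to (scaled⇔ (x * c ⁻¹)) ∘ subst (HasNormAndTrace A c) (sym (*-/-cancelˡ x c≢0))

      tr≡0⇒count≡0 : trace n γ ≡ 0# → cyclotomicNumber ω (Q ∸ 1) a b ≡ 0
      tr≡0⇒count≡0 trγ≡0 = cyclotomicNumber≡ [] [] λ x →
        mk⇔ (λ sol → ⊥-elim (0≢1 (trans (sym trγ≡0) (proj₁ (descale sol))))) λ ()

      tr≡1⇒count≡2 : trace n γ ≡ 1# → cyclotomicNumber ω (Q ∸ 1) a b ≡ 2
      tr≡1⇒count≡2 trγ≡1 with ∃x²+x≡ γ∈ trγ≡1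
        where
        γ∈ : InSubfield γ
        γ∈ = *-∈ (power-∈ a) (⁻¹-∈ (^≢0 2 c≢0) (^-∈ 2 c∈))
      ... | y₀ , y₀²+y₀≡γ = cyclotomicNumber≡ roots ((cy₀≢cy₀+c ∷ []) ∷ [] ∷ []) solutions⇔
        where
        roots : List Carrier
        roots = c * y₀ ∷ c * (y₀ + 1#) ∷ []

        cy₀≢cy₀+c : c * y₀ ≢ c * (y₀ + 1#)
        cy₀≢cy₀+c eq = 0≢1 (+-cancelˡ y₀ 0# 1# (trans (+-identityʳ y₀) (*-cancelˡ c≢0 eq)))

        ∈-roots : ∀ {x} → x * c ⁻¹ ≡ y₀ ⊎ x * c ⁻¹ ≡ y₀ + 1# → x ∈ roots
        ∈-roots {x} (inj₁ y≡y₀)   = here (trans (sym (*-/-cancelˡ x c≢0)) (cong (c *_) y≡y₀))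
        ∈-roots {x} (inj₂ y≡y₀+1) = there (here (trans (sym (*-/-cancelˡ x c≢0)) (cong (c *_) y≡y₀+1)))

        solutions⇔ : ∀ x → HasNormAndTrace A c x ⇔ x ∈ roots
        solutions⇔ x = mk⇔
          (λ sol → ∈-roots (x²+x≡y²+y⇒x≡y⊎x≡y+1 (trans (proj₂ (descale sol)) (sym y₀²+y₀≡γ))))
          λ { (here refl)         → Equivalence.from (scaled⇔ y₀) (trγ≡1 , y₀²+y₀≡γ)
            ; (there (here refl)) → Equivalence.from (scaled⇔ (y₀ + 1#))
                                      (trγ≡1 , trans ([x+1]²+[x+1] y₀) y₀²+y₀≡γ) }

open import Data.Nat using (ℕ; _≤_; _∸_; _^_; _*_; _+_)
open import Data.Product using (_×_)
open import Relation.Nullary using (¬_)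
open import Relation.Binary.PropositionalEquality using (_≡_)
open FiniteField using (Carrier; 0#; 1#; IsPrimitive; cyclotomicNumber)

proposition3p6 : (n : ℕ) → 1 ≤ n →
    (K : FiniteField ((2 ^ n) * (2 ^ n))) → (ω : Carrier K) → IsPrimitive K ω →
    (a b : ℕ) → a ≤ (2 ^ n) ∸ 2 → b ≤ (2 ^ n) ∸ 2 →
      (cValue K ω n a b ≡ 0# K → cyclotomicNumber K ω ((2 ^ n) ∸ 1) a b ≡ 1)
      × (¬ (cValue K ω n a b ≡ 0# K) → traceValue K ω n a b ≡ 0# K →
          cyclotomicNumber K ω ((2 ^ n) ∸ 1) a b ≡ 0)
      × (¬ (cValue K ω n a b ≡ 0# K) → traceValue K ω n a b ≡ 1# K →
          cyclotomicNumber K ω ((2 ^ n) ∸ 1) a b ≡ 2)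
proposition3p6 n 1≤n K ω ω-primitive a b _ _ = c≡0⇒count≡1 , tr≡0⇒count≡0 , tr≡1⇒count≡2
  where
  open QuadraticExtension n {{ℕ.>-nonZero 1≤n}} K ω-primitive
  open Cyclotomic a b
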